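{- Let $\mathcal S$ and $\mathcal G$ be semifilters on $\omega$ with $\mathcal S\geq_{RB}\mathcal G$. Then $\mathfrak p_{\mathcal S}\le\mathfrak p_{\mathcal G}$ and $\mathfrak t_{\mathcal S}\le\mathfrak t_{\mathcal G}$.
   Context: For $A,B\subseteq\omega$, $A\subseteq^* B$ means $A\setminus B$ is finite. A semifilter on $\omega$ is a set $\mathcal S\subseteq\mathcal P(\omega)$ with $\emptyset\neq\mathcal S\neq\mathcal P(\omega)$ closed upwards under $\subseteq^*$; it is regarded as a partial order under $\subseteq^*$. For a semifilter $\mathcal S$: a family $\mathcal H\subseteq\mathcal S$ is centered if every finite subfamily has a lower bound in $(\mathcal S,\subseteq^*)$; a lower bound for $\mathcal H$ in $\mathcal S$ is some $A\in\mathcal S$ with $A\subseteq^* H$ for all $H\in\mathcal H$; $\mathcal H$ is unbounded if it has no lower bound in $\mathcal S$. $\mathfrak p_{\mathcal S}$ is the smallest cardinality of an unbounded centered subset of $\mathcal S$, and $\mathfrak t_{\mathcal S}$ is the smallest cardinality of an unbounded chain (subset linearly ordered by $\subseteq^*$) in $\mathcal S$ (taken to be $\infty$ if no such family exists). For semifilters $\mathcal S,\mathcal G$, $\mathcal S\geq_{RB}\mathcal G$ (Rudin–Blass) means there is a finite-to-one function $f:\omega\to\omega$ such that for all $A\subseteq\omega$, $A\in\mathcal G$ iff $f^{ -1}[A]\in\mathcal S$. -}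

module Defs where

open import Data.Nat using (ℕ; _≤_; _<_)
open import Data.Bool using (Bool; true)
open import Data.Product using (Σ; ∃; _×_)
open import Data.Sum using (_⊎_)
open import Data.List using (List)
open import Data.List.Relation.Unary.All using (All)
open import Relation.Nullary using (¬_)
open import Relation.Binary.PropositionalEquality using (_≡_)
open import Function.Bundles using (_↣_)

Subset : Set
Subset = ℕ → Bool

_∈_ : ℕ → Subset → Set
n ∈ A = A n ≡ true

-- A ⊆* B : A ∖ B is finite, i.e. bounded.
_⊆*_ : Subset → Subset → Set
A ⊆* B = ∃ λ N → ∀ n → N ≤ n → n ∈ A → n ∈ B

Family : Set₁
Family = Subset → Set

record IsSemifilter (𝒮 : Family) : Set where
  field
    nonempty : ∃ λ A → 𝒮 A
    proper   : ∃ λ A → ¬ 𝒮 A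
    upward   : ∀ A B → 𝒮 A → A ⊆* B → 𝒮 B

-- Families of elements of 𝒮 are given as indexed families H : I → Subset
-- with every H i ∈ 𝒮; the cardinality of the family is measured by |I|.
InFamily : (𝒮 : Family) {I : Set} → (I → Subset) → Set
InFamily 𝒮 {I} H = ∀ i → 𝒮 (H i)

IsLowerBound : (𝒮 : Family) {I : Set} → (I → Subset) → Subset → Set
IsLowerBound 𝒮 {I} H A = 𝒮 A × (∀ i → A ⊆* H i)

IsCentered : (𝒮 : Family) {I : Set} → (I → Subset) → Set
IsCentered 𝒮 {I} H =
  ∀ (is : List I) → ∃ λ A → 𝒮 A × All (λ i → A ⊆* H i) is

IsUnbounded : (𝒮 : Family) {I : Set} → (I → Subset) → Set
IsUnbounded 𝒮 H = ¬ (∃ λ A → IsLowerBound 𝒮 H A)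

IsChain : {I : Set} → (I → Subset) → Set
IsChain {I} H = ∀ i j → (H i ⊆* H j) ⊎ (H j ⊆* H i)

UnboundedCentered : Family → {I : Set} → (I → Subset) → Set
UnboundedCentered 𝒮 H = InFamily 𝒮 H × IsCentered 𝒮 H × IsUnbounded 𝒮 H

UnboundedChain : Family → {I : Set} → (I → Subset) → Set
UnboundedChain 𝒮 H = InFamily 𝒮 H × IsChain H × IsUnbounded 𝒮 H

-- 𝔭_𝒮 ≤ 𝔭_𝒢 (with the convention min ∅ = ∞): for every unbounded centered
-- family in 𝒢 there is one in 𝒮 of no larger cardinality.
𝔭-≤ : Family → Family → Set₁
𝔭-≤ 𝒮 𝒢 = ∀ (I : Set) (H : I → Subset) → UnboundedCentered 𝒢 H →
  Σ Set λ J → Σ (J → Subset) λ K → UnboundedCentered 𝒮 K × (J ↣ I)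

𝔱-≤ : Family → Family → Set₁
𝔱-≤ 𝒮 𝒢 = ∀ (I : Set) (H : I → Subset) → UnboundedChain 𝒢 H →
  Σ Set λ J → Σ (J → Subset) λ K → UnboundedChain 𝒮 K × (J ↣ I)

FiniteToOne : (ℕ → ℕ) → Set
FiniteToOne f = ∀ m → ∃ λ N → ∀ n → f n ≡ m → n < N

preimage : (ℕ → ℕ) → Subset → Subset
preimage f A n = A (f n)

_≥RB_ : Family → Family → Set
𝒮 ≥RB 𝒢 = ∃ λ (f : ℕ → ℕ) → FiniteToOne f ×
  (∀ A → (𝒢 A → 𝒮 (preimage f A)) × (𝒮 (preimage f A) → 𝒢 A))

module Submission where

-- Let f witness 𝒮 ≥RB 𝒢.  Every family H in 𝒢 is sent to the family
-- i ↦ f⁻¹[H i] in 𝒮, indexed by the same set, so the cardinality does not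
-- grow (the injection required by 𝔭-≤ and 𝔱-≤ is the identity).  Since f is
-- finite-to-one, f⁻¹ is monotone for ⊆*, so it preserves lower bounds of finite
-- subfamilies (centeredness) and comparabilities (chains).  Unboundedness is
-- the real point: given a lower bound C ∈ 𝒮 of the pulled-back family, its
-- image f[C] is a lower bound of H, and it lies in 𝒢 because C ⊆ f⁻¹[f[C]]
-- puts f⁻¹[f[C]] in 𝒮.  The image of a set is computable as a subset of ω
-- because each fibre of f is bounded, so membership is a bounded search.

open import Defs
open import Data.Product using (∃; _×_; _,_; proj₁; proj₂)
open import Data.Sum using (inj₁; inj₂) renaming (map to ⊎-map)
open import Data.Nat using (ℕ; zero; suc; _≤_; _<_; _⊔_; _≟_; _≤?_; s≤s)
open import Data.Nat.Properties
  using (≤-trans; m≤n⇒m<n∨m≡n; m≤m⊔n; m≤n⊔m; <⇒≱; ≰⇒>)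
open import Data.Bool using (true; false)
import Data.Bool.Properties as Bool
open import Data.Fin using (Fin; toℕ; fromℕ<)
open import Data.Fin.Properties using (any?; toℕ-fromℕ<)
open import Data.List using (List; []; _∷_)
open import Data.List.Relation.Unary.All using (All; []; _∷_)
open import Relation.Nullary using (Dec; does; _because_; ofʸ; yes; no; _×-dec_)
open import Relation.Nullary.Decidable using (dec-true)
open import Relation.Binary.PropositionalEquality using (_≡_; refl; subst)
open import Function.Construct.Identity using (↣-id)
open import Data.Empty using (⊥-elim)

boundOnInitialSegment : (b : ℕ → ℕ) (N : ℕ) → ∃ λ M → ∀ k → k < N → b k ≤ M
boundOnInitialSegment b zero = 0 , λ _ ()
boundOnInitialSegment b (suc N) with boundOnInitialSegment b N
... | M , bounded = M ⊔ b N , below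
  where
  below : ∀ k → k < suc N → b k ≤ M ⊔ b N
  below k (s≤s k≤N) with m≤n⇒m<n∨m≡n k≤N
  ... | inj₁ k<N  = ≤-trans (bounded k k<N) (m≤m⊔n M (b N))
  ... | inj₂ refl = m≤n⊔m M (b N)

-- A finite-to-one function tends to infinity: beyond some point all its
-- values are at least N (only the finitely many fibres over [0, N) are avoided).
eventuallyAbove : (f : ℕ → ℕ) → FiniteToOne f →
  ∀ N → ∃ λ M → ∀ n → M ≤ n → N ≤ f n
eventuallyAbove f fto N with boundOnInitialSegment (λ m → proj₁ (fto m)) N
... | M , bounded = M , above
  where
  above : ∀ n → M ≤ n → N ≤ f n
  above n M≤n with N ≤? f n
  ... | yes N≤fn = N≤fn
  ... | no  N≰fn =
    ⊥-elim (<⇒≱ (≤-trans (proj₂ (fto (f n)) n refl) (bounded (f n) (≰⇒> N≰fn))) M≤n)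

does-sound : ∀ {P : Set} (P? : Dec P) → does P? ≡ true → P
does-sound (true because ofʸ p) _ = p
does-sound (false because _) ()

module _ (f : ℕ → ℕ) (fto : FiniteToOne f) where

  -- Preimages along a finite-to-one map are monotone for ⊆*: the finite
  -- exceptional set of A ∖ B pulls back to a finite set.
  preimage-⊆* : ∀ A B → A ⊆* B → preimage f A ⊆* preimage f B
  preimage-⊆* A B (N , A⊆B) with eventuallyAbove f fto N
  ... | M , above = M , λ n M≤n → A⊆B (f n) (above n M≤n)

  -- The image f[C]: m ∈ f[C] is decided by searching the fibre over m,
  -- which lies below the bound proj₁ (fto m).
  searchFibre : (C : Subset) (m : ℕ) → Dec (∃ λ (k : Fin (proj₁ (fto m))) →
    (C (toℕ k) ≡ true) × (f (toℕ k) ≡ m))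
  searchFibre C m = any? λ k → (C (toℕ k) Bool.≟ true) ×-dec (f (toℕ k) ≟ m)

  image : Subset → Subset
  image C m = does (searchFibre C m)

  image-intro : ∀ C n → n ∈ C → f n ∈ image C
  image-intro C n n∈C = dec-true (searchFibre C (f n)) (fromℕ< n<bound , witness)
    where
    n<bound : n < proj₁ (fto (f n))
    n<bound = proj₂ (fto (f n)) n refl
    witness : (C (toℕ (fromℕ< n<bound)) ≡ true) × (f (toℕ (fromℕ< n<bound)) ≡ f n)
    witness rewrite toℕ-fromℕ< n<bound = n∈C , refl

  image-elim : ∀ C m → m ∈ image C → ∃ λ n → n ∈ C × f n ≡ m
  image-elim C m m∈fC with does-sound (searchFibre C m) m∈fC
  ... | k , k∈C , fk≡m = toℕ k , k∈C , fk≡m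

  ⊆-preimage-image : ∀ C → C ⊆* preimage f (image C)
  ⊆-preimage-image C = 0 , λ n _ → image-intro C n

  -- If C ⊆* f⁻¹[B] then f[C] ⊆* B: the finitely many exceptional points of C
  -- have finitely many images, and every larger point of f[C] comes from a
  -- non-exceptional point of C.
  image-⊆* : ∀ C B → C ⊆* preimage f B → image C ⊆* B
  image-⊆* C B (N , C⊆f⁻¹B) with boundOnInitialSegment f N
  ... | M , bounded = suc M , λ m M<m m∈fC → fromImage m M<m (image-elim C m m∈fC)
    where
    fromImage : ∀ m → suc M ≤ m → (∃ λ n → n ∈ C × f n ≡ m) → m ∈ B
    fromImage m M<m (n , n∈C , refl) with N ≤? n
    ... | yes N≤n = C⊆f⁻¹B n N≤n n∈C
    ... | no  N≰n = ⊥-elim (<⇒≱ M<m (bounded n (≰⇒> N≰n)))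

  pullback : ∀ {I : Set} → (I → Subset) → (I → Subset)
  pullback H i = preimage f (H i)

  pullback-lowerBounds : ∀ {I : Set} (H : I → Subset) A (is : List I) →
    All (λ i → A ⊆* H i) is → All (λ i → preimage f A ⊆* pullback H i) is
  pullback-lowerBounds H A [] [] = []
  pullback-lowerBounds H A (i ∷ is) (A⊆Hi ∷ rest) =
    preimage-⊆* A (H i) A⊆Hi ∷ pullback-lowerBounds H A is rest

  pullback-centered : ∀ (𝒮 𝒢 : Family) → (∀ A → 𝒢 A → 𝒮 (preimage f A)) →
    ∀ {I : Set} (H : I → Subset) → IsCentered 𝒢 H → IsCentered 𝒮 (pullback H)
  pullback-centered 𝒮 𝒢 pull H centered is with centered is
  ... | A , A∈𝒢 , A⊆H = preimage f A , pull A A∈𝒢 , pullback-lowerBounds H A is A⊆H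

  pullback-chain : ∀ {I : Set} (H : I → Subset) → IsChain H → IsChain (pullback H)
  pullback-chain H chain i j =
    ⊎-map (preimage-⊆* (H i) (H j)) (preimage-⊆* (H j) (H i)) (chain i j)

  pullback-unbounded : ∀ (𝒮 𝒢 : Family) → (∀ A B → 𝒮 A → A ⊆* B → 𝒮 B) →
    (∀ A → 𝒮 (preimage f A) → 𝒢 A) →
    ∀ {I : Set} (H : I → Subset) → IsUnbounded 𝒢 H → IsUnbounded 𝒮 (pullback H)
  pullback-unbounded 𝒮 𝒢 upward push H unbounded (C , C∈𝒮 , C⊆pullback) =
    unbounded (image C , fC∈𝒢 , λ i → image-⊆* C (H i) (C⊆pullback i))
    where
    fC∈𝒢 : 𝒢 (image C)
    fC∈𝒢 = push (image C) (upward C _ C∈𝒮 (⊆-preimage-image C))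

proposition3p1 : (𝒮 𝒢 : Family) → IsSemifilter 𝒮 → IsSemifilter 𝒢 →
    𝒮 ≥RB 𝒢 → 𝔭-≤ 𝒮 𝒢 × 𝔱-≤ 𝒮 𝒢
proposition3p1 𝒮 𝒢 𝒮-semifilter _ (f , fto , reduces) = 𝔭-bound , 𝔱-bound
  where
  pull : ∀ A → 𝒢 A → 𝒮 (preimage f A)
  pull A = proj₁ (reduces A)
  push : ∀ A → 𝒮 (preimage f A) → 𝒢 A
  push A = proj₂ (reduces A)
  unbounded : ∀ {I : Set} (H : I → Subset) → IsUnbounded 𝒢 H →
    IsUnbounded 𝒮 (pullback f fto H)
  unbounded = pullback-unbounded f fto 𝒮 𝒢 (IsSemifilter.upward 𝒮-semifilter) push

  𝔭-bound : 𝔭-≤ 𝒮 𝒢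
  𝔭-bound I H (H⊆𝒢 , centered , unboundedH) = I , pullback f fto H ,
    ((λ i → pull (H i) (H⊆𝒢 i)) , pullback-centered f fto 𝒮 𝒢 pull H centered ,
     unbounded H unboundedH) , ↣-id I
  𝔱-bound : 𝔱-≤ 𝒮 𝒢
  𝔱-bound I H (H⊆𝒢 , chain , unboundedH) = I , pullback f fto H ,
    ((λ i → pull (H i) (H⊆𝒢 i)) , pullback-chain f fto H chain ,
     unbounded H unboundedH) , ↣-id I
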